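{- For every finite multiset of formulas $\Gamma$ and every formula $\varphi$: if $\Gamma\models_{\mathbf{K}_3}\varphi$, then BSC-K$_3\vdash\Gamma\Rightarrow\varphi\mid\ \Rightarrow$ (the bisequent whose 1-sequent is $\Gamma\Rightarrow\varphi$ and whose 2-sequent is empty on both sides).
   Context: Formulas are built from propositional atoms with connectives $\neg,\wedge,\vee,\rightarrow$. A $\mathbf{K}_3$-valuation is a homomorphism $h$ from formulas to $\{0,u,1\}$ (ordered $0<u<1$) with: $h(\neg\varphi)=1,u,0$ when $h(\varphi)=0,u,1$; $h(\varphi\wedge\psi)=\min(h(\varphi),h(\psi))$; $h(\varphi\vee\psi)=\max(h(\varphi),h(\psi))$; $h(\varphi\rightarrow\psi)=\max(h(\neg\varphi),h(\psi))$. $\Gamma\models_{\mathbf{K}_3}\varphi$ means: for every valuation $h$, if $h(\gamma)=1$ for all $\gamma\in\Gamma$ then $h(\varphi)=1$. A sequent is $\Gamma\Rightarrow\Delta$ with $\Gamma,\Delta$ finite multisets of formulas; a bisequent is an ordered pair of sequents $\Gamma\Rightarrow\Delta\mid\Pi\Rightarrow\Sigma$. A bisequent is axiomatic iff some formula occurs in both $\Gamma$ and $\Sigma$, or in both $\Gamma$ and $\Delta$, or in both $\Pi$ and $\Sigma$. BSC-K$_3\vdash B$ means there is a finite tree of bisequents with root $B$, all of whose leaves are axiomatic, and in which every non-leaf node is the conclusion of an instance of one of the following rules whose premisses are exactly its children ($S$ denotes an arbitrary sequent): $(\neg\Rightarrow\mid)$: from $\Gamma\Rightarrow\Delta\mid\Pi\Rightarrow\Sigma,\varphi$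 infer $\neg\varphi,\Gamma\Rightarrow\Delta\mid\Pi\Rightarrow\Sigma$. $(\Rightarrow\neg\mid)$: from $\Gamma\Rightarrow\Delta\mid\varphi,\Pi\Rightarrow\Sigma$ infer $\Gamma\Rightarrow\Delta,\neg\varphi\mid\Pi\Rightarrow\Sigma$. $(\mid\neg\Rightarrow)$: from $\Gamma\Rightarrow\Delta,\varphi\mid\Pi\Rightarrow\Sigma$ infer $\Gamma\Rightarrow\Delta\mid\neg\varphi,\Pi\Rightarrow\Sigma$. $(\mid\Rightarrow\neg)$: from $\varphi,\Gamma\Rightarrow\Delta\mid\Pi\Rightarrow\Sigma$ infer $\Gamma\Rightarrow\Delta\mid\Pi\Rightarrow\Sigma,\neg\varphi$. $(\wedge\Rightarrow\mid)$: from $\varphi,\psi,\Gamma\Rightarrow\Delta\mid S$ infer $\varphi\wedge\psi,\Gamma\Rightarrow\Delta\mid S$. $(\Rightarrow\wedge\mid)$: from $\Gamma\Rightarrow\Delta,\varphi\mid S$ and $\Gamma\Rightarrow\Delta,\psi\mid S$ infer $\Gamma\Rightarrow\Delta,\varphi\wedge\psi\mid S$. $(\mid\wedge\Rightarrow)$: from $S\mid\varphi,\psi,\Gamma\Rightarrow\Delta$ infer $S\mid\varphi\wedge\psi,\Gamma\Rightarrow\Delta$. $(\mid\Rightarrow\wedge)$: from $S\mid\Gamma\Rightarrow\Delta,\varphi$ and $S\mid\Gamma\Rightarrow\Delta,\psi$ infer $S\mid\Gamma\Rightarrow\Delta,\varphi\wedge\psi$. $(\Rightarrow\vee\mid)$: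 from $\Gamma\Rightarrow\Delta,\varphi,\psi\mid S$ infer $\Gamma\Rightarrow\Delta,\varphi\vee\psi\mid S$. $(\vee\Rightarrow\mid)$: from $\varphi,\Gamma\Rightarrow\Delta\mid S$ and $\psi,\Gamma\Rightarrow\Delta\mid S$ infer $\varphi\vee\psi,\Gamma\Rightarrow\Delta\mid S$. $(\mid\Rightarrow\vee)$: from $S\mid\Gamma\Rightarrow\Delta,\varphi,\psi$ infer $S\mid\Gamma\Rightarrow\Delta,\varphi\vee\psi$. $(\mid\vee\Rightarrow)$: from $S\mid\varphi,\Gamma\Rightarrow\Delta$ and $S\mid\psi,\Gamma\Rightarrow\Delta$ infer $S\mid\varphi\vee\psi,\Gamma\Rightarrow\Delta$. $(\Rightarrow\rightarrow\mid)$: from $\Gamma\Rightarrow\Delta,\psi\mid\varphi,\Pi\Rightarrow\Sigma$ infer $\Gamma\Rightarrow\Delta,\varphi\rightarrow\psi\mid\Pi\Rightarrow\Sigma$. $(\mid\Rightarrow\rightarrow)$: from $\varphi,\Gamma\Rightarrow\Delta\mid\Pi\Rightarrow\Sigma,\psi$ infer $\Gamma\Rightarrow\Delta\mid\Pi\Rightarrow\Sigma,\varphi\rightarrow\psi$. $(\rightarrow\Rightarrow\mid)$: from $\Gamma\Rightarrow\Delta\mid\Pi\Rightarrow\Sigma,\varphi$ and $\psi,\Gamma\Rightarrow\Delta\mid\Pi\Rightarrow\Sigma$ infer $\varphi\rightarrow\psi,\Gamma\Rightarrow\Delta\mid\Pi\Rightarrow\Sigma$. $(\mid\rightarrow\Rightarrow)$: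 from $\Gamma\Rightarrow\Delta,\varphi\mid\Pi\Rightarrow\Sigma$ and $\Gamma\Rightarrow\Delta\mid\psi,\Pi\Rightarrow\Sigma$ infer $\Gamma\Rightarrow\Delta\mid\varphi\rightarrow\psi,\Pi\Rightarrow\Sigma$. -}

module Defs where

open import Data.Nat using (ℕ)
open import Data.List using (List; []; _∷_)
open import Data.List.Membership.Propositional using (_∈_)
open import Data.List.Relation.Unary.All using (All)
open import Data.List.Relation.Binary.Permutation.Propositional using (_↭_)
open import Data.Product using (∃; _×_)
open import Data.Sum using (_⊎_)
open import Relation.Binary.PropositionalEquality using (_≡_)

data Formula : Set where
  atom : ℕ → Formula
  ¬'_  : Formula → Formula
  _∧'_ : Formula → Formula → Formula
  _∨'_ : Formula → Formula → Formula
  _⇒'_ : Formula → Formula → Formula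

data K3 : Set where
  f0 u t1 : K3

neg : K3 → K3
neg f0 = t1
neg u  = u
neg t1 = f0

min : K3 → K3 → K3
min f0 _  = f0
min u  f0 = f0
min u  _  = u
min t1 y  = y

max : K3 → K3 → K3
max t1 _  = t1
max u  t1 = t1
max u  _  = u
max f0 y  = y

eval : (ℕ → K3) → Formula → K3
eval v (atom p) = v p
eval v (¬' φ)   = neg (eval v φ)
eval v (φ ∧' ψ) = min (eval v φ) (eval v ψ)
eval v (φ ∨' ψ) = max (eval v φ) (eval v ψ)
eval v (φ ⇒' ψ) = max (neg (eval v φ)) (eval v ψ)

_⊨K3_ : List Formula → Formula → Set
Γ ⊨K3 φ = (v : ℕ → K3) → All (λ γ → eval v γ ≡ t1) Γ → eval v φ ≡ t1

-- Multisets are represented as lists, taken up to permutation (rule `exch`).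
record Bisequent : Set where
  constructor _⇒_∣_⇒_
  field
    Γ Δ Π Σ : List Formula

infix 4 _⇒_∣_⇒_

Axiomatic : Bisequent → Set
Axiomatic (Γ ⇒ Δ ∣ Π ⇒ Σ) =
  (∃ λ φ → φ ∈ Γ × φ ∈ Σ) ⊎ (∃ λ φ → φ ∈ Γ × φ ∈ Δ) ⊎ (∃ λ φ → φ ∈ Π × φ ∈ Σ)

-- Derivability in BSC-K3. Principal formulas are written at the head of a
-- list; `exch` identifies bisequents whose components are equal as multisets.
data ⊢ : Bisequent → Set where
  ax   : ∀ {B} → Axiomatic B → ⊢ B
  exch : ∀ {Γ Γ' Δ Δ' Π Π' Σ Σ'} → Γ ↭ Γ' → Δ ↭ Δ' → Π ↭ Π' → Σ ↭ Σ' →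
         ⊢ (Γ' ⇒ Δ' ∣ Π' ⇒ Σ') → ⊢ (Γ ⇒ Δ ∣ Π ⇒ Σ)
  ¬⇒∣  : ∀ {Γ Δ Π Σ φ} → ⊢ (Γ ⇒ Δ ∣ Π ⇒ φ ∷ Σ) → ⊢ (¬' φ ∷ Γ ⇒ Δ ∣ Π ⇒ Σ)
  ⇒¬∣  : ∀ {Γ Δ Π Σ φ} → ⊢ (Γ ⇒ Δ ∣ φ ∷ Π ⇒ Σ) → ⊢ (Γ ⇒ ¬' φ ∷ Δ ∣ Π ⇒ Σ)
  ∣¬⇒  : ∀ {Γ Δ Π Σ φ} → ⊢ (Γ ⇒ φ ∷ Δ ∣ Π ⇒ Σ) → ⊢ (Γ ⇒ Δ ∣ ¬' φ ∷ Π ⇒ Σ)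
  ∣⇒¬  : ∀ {Γ Δ Π Σ φ} → ⊢ (φ ∷ Γ ⇒ Δ ∣ Π ⇒ Σ) → ⊢ (Γ ⇒ Δ ∣ Π ⇒ ¬' φ ∷ Σ)
  ∧⇒∣  : ∀ {Γ Δ Π Σ φ ψ} → ⊢ (φ ∷ ψ ∷ Γ ⇒ Δ ∣ Π ⇒ Σ) → ⊢ (φ ∧' ψ ∷ Γ ⇒ Δ ∣ Π ⇒ Σ)
  ⇒∧∣  : ∀ {Γ Δ Π Σ φ ψ} → ⊢ (Γ ⇒ φ ∷ Δ ∣ Π ⇒ Σ) → ⊢ (Γ ⇒ ψ ∷ Δ ∣ Π ⇒ Σ) →
         ⊢ (Γ ⇒ φ ∧' ψ ∷ Δ ∣ Π ⇒ Σ)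
  ∣∧⇒  : ∀ {Γ Δ Π Σ φ ψ} → ⊢ (Γ ⇒ Δ ∣ φ ∷ ψ ∷ Π ⇒ Σ) → ⊢ (Γ ⇒ Δ ∣ φ ∧' ψ ∷ Π ⇒ Σ)
  ∣⇒∧  : ∀ {Γ Δ Π Σ φ ψ} → ⊢ (Γ ⇒ Δ ∣ Π ⇒ φ ∷ Σ) → ⊢ (Γ ⇒ Δ ∣ Π ⇒ ψ ∷ Σ) →
         ⊢ (Γ ⇒ Δ ∣ Π ⇒ φ ∧' ψ ∷ Σ)
  ⇒∨∣  : ∀ {Γ Δ Π Σ φ ψ} → ⊢ (Γ ⇒ φ ∷ ψ ∷ Δ ∣ Π ⇒ Σ) → ⊢ (Γ ⇒ φ ∨' ψ ∷ Δ ∣ Π ⇒ Σ)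
  ∨⇒∣  : ∀ {Γ Δ Π Σ φ ψ} → ⊢ (φ ∷ Γ ⇒ Δ ∣ Π ⇒ Σ) → ⊢ (ψ ∷ Γ ⇒ Δ ∣ Π ⇒ Σ) →
         ⊢ (φ ∨' ψ ∷ Γ ⇒ Δ ∣ Π ⇒ Σ)
  ∣⇒∨  : ∀ {Γ Δ Π Σ φ ψ} → ⊢ (Γ ⇒ Δ ∣ Π ⇒ φ ∷ ψ ∷ Σ) → ⊢ (Γ ⇒ Δ ∣ Π ⇒ φ ∨' ψ ∷ Σ)
  ∣∨⇒  : ∀ {Γ Δ Π Σ φ ψ} → ⊢ (Γ ⇒ Δ ∣ φ ∷ Π ⇒ Σ) → ⊢ (Γ ⇒ Δ ∣ ψ ∷ Π ⇒ Σ) →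
         ⊢ (Γ ⇒ Δ ∣ φ ∨' ψ ∷ Π ⇒ Σ)
  ⇒→∣  : ∀ {Γ Δ Π Σ φ ψ} → ⊢ (Γ ⇒ ψ ∷ Δ ∣ φ ∷ Π ⇒ Σ) → ⊢ (Γ ⇒ φ ⇒' ψ ∷ Δ ∣ Π ⇒ Σ)
  ∣⇒→  : ∀ {Γ Δ Π Σ φ ψ} → ⊢ (φ ∷ Γ ⇒ Δ ∣ Π ⇒ ψ ∷ Σ) → ⊢ (Γ ⇒ Δ ∣ Π ⇒ φ ⇒' ψ ∷ Σ)
  →⇒∣  : ∀ {Γ Δ Π Σ φ ψ} → ⊢ (Γ ⇒ Δ ∣ Π ⇒ φ ∷ Σ) → ⊢ (ψ ∷ Γ ⇒ Δ ∣ Π ⇒ Σ) →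
         ⊢ (φ ⇒' ψ ∷ Γ ⇒ Δ ∣ Π ⇒ Σ)
  ∣→⇒  : ∀ {Γ Δ Π Σ φ ψ} → ⊢ (Γ ⇒ φ ∷ Δ ∣ Π ⇒ Σ) → ⊢ (Γ ⇒ Δ ∣ ψ ∷ Π ⇒ Σ) →
         ⊢ (Γ ⇒ Δ ∣ φ ⇒' ψ ∷ Π ⇒ Σ)

-- Every rule of BSC-K3 is invertible in a strong semantic sense: reading
-- Γ ⇒ Δ ∣ Π ⇒ Σ as "Γ take value 1, Δ do not take 1, Π do not take 0, Σ take 0",
-- a valuation meeting these demands for some premise meets them for the
-- conclusion. Decomposing formulas root-first therefore never loses a
-- counter-model, and it terminates since premises are smaller. A leaf consisting
-- of atoms is either axiomatic, or refuted by the valuation sending p to 1 if p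
-- is in Γ, to 0 if p is in Σ, and to u otherwise. Hence every bisequent is
-- derivable or refuted, and a refutation of Γ ⇒ φ ∣ ⇒ contradicts Γ ⊨ φ.

module Submission where

open import Defs
open import Data.Bool using (Bool; true; false; if_then_else_)
open import Data.Empty using (⊥; ⊥-elim)
open import Data.List using (List; []; _∷_; _++_; map; mapMaybe)
open import Data.List.Properties using (++-assoc; ++-identityʳ)
open import Data.List.Membership.Propositional using (_∈_; find; lose)
open import Data.List.Membership.Propositional.Properties using (∈-map⁺)
open import Data.Nat using (ℕ; suc; _≟_; _+_; _∸_; _⊓_; _⊔_; _≤_; _<_; z≤n; s≤s)
open import Data.List.Membership.DecPropositional _≟_ using (_∈?_)
open import Data.List.Relation.Binary.Disjoint.Propositional using (Disjoint)
open import Data.List.Relation.Binary.Permutation.Propositional using (_↭_; ↭-sym; ↭-reflexive)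
open import Data.List.Relation.Binary.Permutation.Propositional.Properties using (All-resp-↭; mapMaybe-↭; shift)
open import Data.List.Relation.Unary.All as All using (All; []; _∷_; tabulate)
import Data.List.Relation.Unary.All.Properties as All
open import Data.List.Relation.Unary.Any using (Any; here; there; any?)
open import Data.Maybe using (Maybe; just; nothing)
open import Data.Nat.Induction using (<-wellFounded)
open import Data.Nat.Properties
  using (≤-refl; ≤-reflexive; ≤-trans; +-assoc; +-identityʳ; +-monoʳ-≤; +-monoˡ-<; m≤n+m;
         ∸-monoʳ-≤; ⊓-glb; ⊔-lub; m≤n⇒m⊓o≤n; m≤n⇒o⊓m≤n; m≤n⇒m≤n⊔o; m≤n⇒m≤o⊔n)
open import Data.Product using (∃; _×_; _,_; map₂)
open import Data.Sum using (_⊎_; inj₁; inj₂)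
open import Data.Unit using (⊤)
open import Function using (_∘_)
open import Induction.WellFounded using (Acc; acc)
open import Relation.Nullary using (¬_; yes; no)
open import Relation.Binary.PropositionalEquality using (_≡_; refl; sym; trans; cong; cong₂; subst)

-- Values are computed in the chain 0 < 1 < 2 of ℕ, where min, max and neg become
-- ⊓, ⊔ and 2 ∸_, so that the lattice reasoning comes from Data.Nat.Properties.
toℕ : K3 → ℕ
toℕ f0 = 0
toℕ u  = 1
toℕ t1 = 2

toℕ-neg : ∀ a → toℕ (neg a) ≡ 2 ∸ toℕ a
toℕ-neg f0 = refl
toℕ-neg u  = refl
toℕ-neg t1 = refl

toℕ-min : ∀ a b → toℕ (min a b) ≡ toℕ a ⊓ toℕ b
toℕ-min f0 _  = refl
toℕ-min u  f0 = refl
toℕ-min u  u  = refl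
toℕ-min u  t1 = refl
toℕ-min t1 f0 = refl
toℕ-min t1 u  = refl
toℕ-min t1 t1 = refl

toℕ-max : ∀ a b → toℕ (max a b) ≡ toℕ a ⊔ toℕ b
toℕ-max f0 _  = refl
toℕ-max u  f0 = refl
toℕ-max u  u  = refl
toℕ-max u  t1 = refl
toℕ-max t1 f0 = refl
toℕ-max t1 u  = refl
toℕ-max t1 t1 = refl

evalℕ : (ℕ → ℕ) → Formula → ℕ
evalℕ ρ (atom p) = ρ p
evalℕ ρ (¬' φ)   = 2 ∸ evalℕ ρ φ
evalℕ ρ (φ ∧' ψ) = evalℕ ρ φ ⊓ evalℕ ρ ψ
evalℕ ρ (φ ∨' ψ) = evalℕ ρ φ ⊔ evalℕ ρ ψ
evalℕ ρ (φ ⇒' ψ) = (2 ∸ evalℕ ρ φ) ⊔ evalℕ ρ ψ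

toℕ-eval : ∀ v φ → toℕ (eval v φ) ≡ evalℕ (toℕ ∘ v) φ
toℕ-eval v (atom p) = refl
toℕ-eval v (¬' φ)   = trans (toℕ-neg (eval v φ)) (cong (2 ∸_) (toℕ-eval v φ))
toℕ-eval v (φ ∧' ψ) = trans (toℕ-min (eval v φ) (eval v ψ)) (cong₂ _⊓_ (toℕ-eval v φ) (toℕ-eval v ψ))
toℕ-eval v (φ ∨' ψ) = trans (toℕ-max (eval v φ) (eval v ψ)) (cong₂ _⊔_ (toℕ-eval v φ) (toℕ-eval v ψ))
toℕ-eval v (φ ⇒' ψ) = trans (toℕ-max (neg (eval v φ)) (eval v ψ)) (cong₂ _⊔_ (trans (toℕ-neg (eval v φ)) (cong (2 ∸_) (toℕ-eval v φ))) (toℕ-eval v ψ))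

-- A sign names a place of Γ ⇒ Δ ∣ Π ⇒ Σ (in the order is1, not1, not0, is0), and
-- σ ∋ n is the condition a counter-model must meet there: value 1, not 1, not 0, 0.

data Sign : Set where
  is1 not1 not0 is0 : Sign

infix 4 _∋_

_∋_ : Sign → ℕ → Set
is1  ∋ n = 2 ≤ n
not1 ∋ n = n ≤ 1
not0 ∋ n = 1 ≤ n
is0  ∋ n = n ≤ 0

dual : Sign → Sign
dual is1  = is0
dual not1 = not0
dual not0 = not1
dual is0  = is1

∋-2∸ : ∀ σ {n} → dual σ ∋ n → σ ∋ 2 ∸ n
∋-2∸ is1  = ∸-monoʳ-≤ 2
∋-2∸ not1 = ∸-monoʳ-≤ 2
∋-2∸ not0 = ∸-monoʳ-≤ 2
∋-2∸ is0  = ∸-monoʳ-≤ 2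

Signed : Set
Signed = Sign × Formula

infix 4 _⊩_

_⊩_ : (ℕ → ℕ) → Signed → Set
ρ ⊩ (σ , φ) = σ ∋ evalℕ ρ φ

⊩-is1 : ∀ v {φ} → toℕ ∘ v ⊩ (is1 , φ) → eval v φ ≡ t1
⊩-is1 v {φ} h = toℕ-2≤ (subst (2 ≤_) (sym (toℕ-eval v φ)) h)
  where
  toℕ-2≤ : ∀ {a} → 2 ≤ toℕ a → a ≡ t1
  toℕ-2≤ {t1} _ = refl
  toℕ-2≤ {u} (s≤s ())

⊩-not1 : ∀ v {φ} → toℕ ∘ v ⊩ (not1 , φ) → ¬ eval v φ ≡ t1
⊩-not1 v {φ} h eq with subst (_≤ 1) (trans (sym (toℕ-eval v φ)) (cong toℕ eq)) h
... | s≤s ()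

sameSign : Sign → Sign → Bool
sameSign is1  is1  = true
sameSign not1 not1 = true
sameSign not0 not0 = true
sameSign is0  is0  = true
sameSign _    _    = false

sameSign-refl : ∀ σ → sameSign σ σ ≡ true
sameSign-refl is1  = refl
sameSign-refl not1 = refl
sameSign-refl not0 = refl
sameSign-refl is0  = refl

selected : ∀ {A : Set} → Sign → Sign × A → Maybe A
selected σ (τ , x) = if sameSign σ τ then just x else nothing

part : ∀ {A : Set} → Sign → List (Sign × A) → List A
part σ = mapMaybe (selected σ)

∈-part : ∀ {A : Set} {σ} {x : A} {xs} → (σ , x) ∈ xs → x ∈ part σ xs
∈-part {σ = σ} (here refl) rewrite sameSign-refl σ = here refl
∈-part {σ = σ} {xs = (τ , y) ∷ xs} (there x∈) with sameSign σ τ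
... | true  = there (∈-part x∈)
... | false = ∈-part x∈

part-map₂ : ∀ {A B : Set} (f : A → B) σ xs → part σ (map (map₂ f) xs) ≡ map f (part σ xs)
part-map₂ f σ [] = refl
part-map₂ f σ ((τ , x) ∷ xs) with sameSign σ τ
... | true  = cong (f x ∷_) (part-map₂ f σ xs)
... | false = part-map₂ f σ xs

⟪_⟫ : List Signed → Bisequent
⟪ ss ⟫ = part is1 ss ⇒ part not1 ss ∣ part not0 ss ⇒ part is0 ss

⟪⟫-sequent : ∀ Γ φ → ⟪ (not1 , φ) ∷ map (is1 ,_) Γ ⟫ ≡ (Γ ⇒ φ ∷ [] ∣ [] ⇒ [])
⟪⟫-sequent []      φ = refl
⟪⟫-sequent (γ ∷ Γ) φ =
  cong (λ B → γ ∷ Bisequent.Γ B ⇒ Bisequent.Δ B ∣ Bisequent.Π B ⇒ Bisequent.Σ B) (⟪⟫-sequent Γ φ)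

Refutable : List Signed → Set
Refutable ss = ∃ λ (v : ℕ → K3) → All (toℕ ∘ v ⊩_) ss

Decided : List Signed → Set
Decided ss = ⊢ ⟪ ss ⟫ ⊎ Refutable ss

decided-↭ : ∀ {ss ss'} → ss ↭ ss' → Decided ss' → Decided ss
decided-↭ p (inj₁ d) = inj₁ (exch (mapMaybe-↭ _ p) (mapMaybe-↭ _ p) (mapMaybe-↭ _ p) (mapMaybe-↭ _ p) d)
decided-↭ p (inj₂ (v , sat)) = inj₂ (v , All-resp-↭ (↭-sym p) sat)

atoms : List (Sign × ℕ) → List Signed
atoms = map (map₂ atom)

∈-part-atoms : ∀ {σ p} as → p ∈ part σ as → atom p ∈ part σ (atoms as)
∈-part-atoms {σ} as p∈ = subst (_ ∈_) (sym (part-map₂ atom σ as)) (∈-map⁺ atom p∈)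

shared : (xs ys : List ℕ) → (∃ λ p → p ∈ xs × p ∈ ys) ⊎ Disjoint xs ys
shared xs ys with any? (_∈? ys) xs
... | yes some = inj₁ (find some)
... | no none  = inj₂ λ (p∈xs , p∈ys) → none (lose p∈xs p∈ys)

valuation : List (Sign × ℕ) → ℕ → K3
valuation as p with p ∈? part is1 as | p ∈? part is0 as
... | yes _ | _     = t1
... | no _  | yes _ = f0
... | no _  | no _  = u

module _ (as : List (Sign × ℕ))
         (is1∩not1 : Disjoint (part is1 as) (part not1 as))
         (is1∩is0  : Disjoint (part is1 as) (part is0 as))
         (not0∩is0 : Disjoint (part not0 as) (part is0 as)) where

  ∋-valuation : ∀ σ {p} → p ∈ part σ as → σ ∋ toℕ (valuation as p)
  ∋-valuation is1 {p} p∈ with p ∈? part is1 as | p ∈? part is0 as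
  ... | yes _   | _     = ≤-refl
  ... | no p∉   | _     = ⊥-elim (p∉ p∈)
  ∋-valuation not1 {p} p∈ with p ∈? part is1 as | p ∈? part is0 as
  ... | yes p∈₁ | _     = ⊥-elim (is1∩not1 (p∈₁ , p∈))
  ... | no _    | yes _ = z≤n
  ... | no _    | no _  = ≤-refl
  ∋-valuation not0 {p} p∈ with p ∈? part is1 as | p ∈? part is0 as
  ... | yes _   | _     = s≤s z≤n
  ... | no _    | yes p∈₀ = ⊥-elim (not0∩is0 (p∈ , p∈₀))
  ... | no _    | no _  = ≤-refl
  ∋-valuation is0 {p} p∈ with p ∈? part is1 as | p ∈? part is0 as
  ... | yes p∈₁ | _     = ⊥-elim (is1∩is0 (p∈₁ , p∈))
  ... | no _    | yes _ = z≤n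
  ... | no _    | no p∉ = ⊥-elim (p∉ p∈)

  refuted-by-valuation : Refutable (atoms as)
  refuted-by-valuation =
    valuation as , All.map⁺ (tabulate λ {(σ , p)} σp∈ → ∋-valuation σ (∈-part σp∈))

atoms-decided : ∀ as → Decided (atoms as)
atoms-decided as with shared (part is1 as) (part is0 as)
                    | shared (part is1 as) (part not1 as)
                    | shared (part not0 as) (part is0 as)
... | inj₁ (p , p∈₁ , p∈₂) | _ | _ =
  inj₁ (ax (inj₁ (atom p , ∈-part-atoms as p∈₁ , ∈-part-atoms as p∈₂)))
... | inj₂ _ | inj₁ (p , p∈₁ , p∈₂) | _ =
  inj₁ (ax (inj₂ (inj₁ (atom p , ∈-part-atoms as p∈₁ , ∈-part-atoms as p∈₂))))
... | inj₂ _ | inj₂ _ | inj₁ (p , p∈₁ , p∈₂) =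
  inj₁ (ax (inj₂ (inj₂ (atom p , ∈-part-atoms as p∈₁ , ∈-part-atoms as p∈₂))))
... | inj₂ is1∩is0 | inj₂ is1∩not1 | inj₂ not0∩is0 =
  inj₂ (refuted-by-valuation as is1∩not1 is1∩is0 not0∩is0)

NonAtomic : Formula → Set
NonAtomic (atom _) = ⊥
NonAtomic _        = ⊤

atomic? : ∀ φ → (∃ λ p → φ ≡ atom p) ⊎ NonAtomic φ
atomic? (atom p) = inj₁ (p , refl)
atomic? (¬' _)   = inj₂ _
atomic? (_ ∧' _) = inj₂ _
atomic? (_ ∨' _) = inj₂ _
atomic? (_ ⇒' _) = inj₂ _

both either : Signed → Signed → List (List Signed)
both   s t = (s ∷ t ∷ []) ∷ []
either s t = (s ∷ []) ∷ (t ∷ []) ∷ []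

-- An up-set of the chain contains a meet iff it contains both arguments, a
-- down-set iff it contains one of them; dual exchanges up- and down-sets.
meet join : Sign → Signed → Signed → List (List Signed)
meet is1  = both
meet not1 = either
meet not0 = both
meet is0  = either
join σ = meet (dual σ)

premises : ∀ σ φ → NonAtomic φ → List (List Signed)
premises σ (¬' φ)   _ = ((dual σ , φ) ∷ []) ∷ []
premises σ (φ ∧' ψ) _ = meet σ (σ , φ) (σ , ψ)
premises σ (φ ∨' ψ) _ = join σ (σ , φ) (σ , ψ)
premises σ (φ ⇒' ψ) _ = join σ (dual σ , φ) (σ , ψ)

derive : ∀ σ φ c ss → All (λ bs → ⊢ ⟪ bs ++ ss ⟫) (premises σ φ c) → ⊢ ⟪ (σ , φ) ∷ ss ⟫
derive is1  (¬' φ)   _ ss (d ∷ [])     = ¬⇒∣ d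
derive not1 (¬' φ)   _ ss (d ∷ [])     = ⇒¬∣ d
derive not0 (¬' φ)   _ ss (d ∷ [])     = ∣¬⇒ d
derive is0  (¬' φ)   _ ss (d ∷ [])     = ∣⇒¬ d
derive is1  (φ ∧' ψ) _ ss (d ∷ [])     = ∧⇒∣ d
derive not1 (φ ∧' ψ) _ ss (d ∷ e ∷ []) = ⇒∧∣ d e
derive not0 (φ ∧' ψ) _ ss (d ∷ [])     = ∣∧⇒ d
derive is0  (φ ∧' ψ) _ ss (d ∷ e ∷ []) = ∣⇒∧ d e
derive is1  (φ ∨' ψ) _ ss (d ∷ e ∷ []) = ∨⇒∣ d e
derive not1 (φ ∨' ψ) _ ss (d ∷ [])     = ⇒∨∣ d
derive not0 (φ ∨' ψ) _ ss (d ∷ e ∷ []) = ∣∨⇒ d e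
derive is0  (φ ∨' ψ) _ ss (d ∷ [])     = ∣⇒∨ d
derive is1  (φ ⇒' ψ) _ ss (d ∷ e ∷ []) = →⇒∣ d e
derive not1 (φ ⇒' ψ) _ ss (d ∷ [])     = ⇒→∣ d
derive not0 (φ ⇒' ψ) _ ss (d ∷ e ∷ []) = ∣→⇒ d e
derive is0  (φ ⇒' ψ) _ ss (d ∷ [])     = ∣⇒→ d

⊩-premise⇒⊩ : ∀ σ φ c {ρ bs} → bs ∈ premises σ φ c → All (ρ ⊩_) bs → ρ ⊩ (σ , φ)
⊩-premise⇒⊩ σ    (¬' φ)   _ (here refl)         (p ∷ [])     = ∋-2∸ σ p
⊩-premise⇒⊩ is1  (φ ∧' ψ) _ (here refl)         (p ∷ q ∷ []) = ⊓-glb p q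
⊩-premise⇒⊩ not1 (φ ∧' ψ) _ (here refl)         (p ∷ [])     = m≤n⇒m⊓o≤n _ p
⊩-premise⇒⊩ not1 (φ ∧' ψ) _ (there (here refl)) (q ∷ [])     = m≤n⇒o⊓m≤n _ q
⊩-premise⇒⊩ not0 (φ ∧' ψ) _ (here refl)         (p ∷ q ∷ []) = ⊓-glb p q
⊩-premise⇒⊩ is0  (φ ∧' ψ) _ (here refl)         (p ∷ [])     = m≤n⇒m⊓o≤n _ p
⊩-premise⇒⊩ is0  (φ ∧' ψ) _ (there (here refl)) (q ∷ [])     = m≤n⇒o⊓m≤n _ q
⊩-premise⇒⊩ is1  (φ ∨' ψ) _ (here refl)         (p ∷ [])     = m≤n⇒m≤n⊔o _ p
⊩-premise⇒⊩ is1  (φ ∨' ψ) _ (there (here refl)) (q ∷ [])     = m≤n⇒m≤o⊔n _ q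
⊩-premise⇒⊩ not1 (φ ∨' ψ) _ (here refl)         (p ∷ q ∷ []) = ⊔-lub p q
⊩-premise⇒⊩ not0 (φ ∨' ψ) _ (here refl)         (p ∷ [])     = m≤n⇒m≤n⊔o _ p
⊩-premise⇒⊩ not0 (φ ∨' ψ) _ (there (here refl)) (q ∷ [])     = m≤n⇒m≤o⊔n _ q
⊩-premise⇒⊩ is0  (φ ∨' ψ) _ (here refl)         (p ∷ q ∷ []) = ⊔-lub p q
⊩-premise⇒⊩ is1  (φ ⇒' ψ) _ (here refl)         (p ∷ [])     = m≤n⇒m≤n⊔o _ (∋-2∸ is1 p)
⊩-premise⇒⊩ is1  (φ ⇒' ψ) _ (there (here refl)) (q ∷ [])     = m≤n⇒m≤o⊔n _ q
⊩-premise⇒⊩ not1 (φ ⇒' ψ) _ (here refl)         (p ∷ q ∷ []) = ⊔-lub (∋-2∸ not1 p) q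
⊩-premise⇒⊩ not0 (φ ⇒' ψ) _ (here refl)         (p ∷ [])     = m≤n⇒m≤n⊔o _ (∋-2∸ not0 p)
⊩-premise⇒⊩ not0 (φ ⇒' ψ) _ (there (here refl)) (q ∷ [])     = m≤n⇒m≤o⊔n _ q
⊩-premise⇒⊩ is0  (φ ⇒' ψ) _ (here refl)         (p ∷ q ∷ []) = ⊔-lub (∋-2∸ is0 p) q

All-⊎⁻ : ∀ {A : Set} {P Q : A → Set} {xs} → All (λ x → P x ⊎ Q x) xs → All P xs ⊎ Any Q xs
All-⊎⁻ []            = inj₁ []
All-⊎⁻ (inj₂ q ∷ _)  = inj₂ (here q)
All-⊎⁻ (inj₁ p ∷ ps) with All-⊎⁻ ps
... | inj₁ ps' = inj₁ (p ∷ ps')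
... | inj₂ qs  = inj₂ (there qs)

decided-conclusion : ∀ σ φ c ss →
  (∀ {bs} → bs ∈ premises σ φ c → Decided (bs ++ ss)) → Decided ((σ , φ) ∷ ss)
decided-conclusion σ φ c ss decided with All-⊎⁻ (tabulate decided)
... | inj₁ derivable = inj₁ (derive σ φ c ss derivable)
... | inj₂ refutable with find refutable
...   | bs , bs∈ , v , sat =
  inj₂ (v , ⊩-premise⇒⊩ σ φ c bs∈ (All.++⁻ˡ bs sat) ∷ All.++⁻ʳ bs sat)

size : Formula → ℕ
size (atom _) = 1
size (¬' φ)   = suc (size φ)
size (φ ∧' ψ) = suc (size φ + size ψ)
size (φ ∨' ψ) = suc (size φ + size ψ)
size (φ ⇒' ψ) = suc (size φ + size ψ)

weight : List Signed → ℕ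
weight []            = 0
weight ((_ , φ) ∷ ss) = size φ + weight ss

weight-++ : ∀ bs ss → weight (bs ++ ss) ≡ weight bs + weight ss
weight-++ []             ss = refl
weight-++ ((_ , φ) ∷ bs) ss = trans (cong (size φ +_) (weight-++ bs ss)) (sym (+-assoc (size φ) _ _))

both-≤ : ∀ {s t bs} → bs ∈ both s t → weight bs ≤ weight (s ∷ t ∷ [])
both-≤ (here refl) = ≤-refl

either-≤ : ∀ {s t bs} → bs ∈ either s t → weight bs ≤ weight (s ∷ t ∷ [])
either-≤ {s = _ , φ} (here refl)         = +-monoʳ-≤ (size φ) z≤n
either-≤ {s = _ , φ} (there (here refl)) = m≤n+m _ (size φ)

meet-≤ : ∀ σ {s t bs} → bs ∈ meet σ s t → weight bs ≤ weight (s ∷ t ∷ [])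
meet-≤ is1  = both-≤
meet-≤ not1 = either-≤
meet-≤ not0 = both-≤
meet-≤ is0  = either-≤

weight-pair : ∀ σ τ φ ψ → weight ((σ , φ) ∷ (τ , ψ) ∷ []) ≤ size φ + size ψ
weight-pair _ _ φ ψ = ≤-reflexive (cong (size φ +_) (+-identityʳ (size ψ)))

premises-< : ∀ σ φ c {bs} → bs ∈ premises σ φ c → weight bs < size φ
premises-< σ (¬' φ)   _ (here refl) = s≤s (≤-reflexive (+-identityʳ (size φ)))
premises-< σ (φ ∧' ψ) _ bs∈ = s≤s (≤-trans (meet-≤ σ bs∈) (weight-pair σ σ φ ψ))
premises-< σ (φ ∨' ψ) _ bs∈ = s≤s (≤-trans (meet-≤ (dual σ) bs∈) (weight-pair σ σ φ ψ))
premises-< σ (φ ⇒' ψ) _ bs∈ = s≤s (≤-trans (meet-≤ (dual σ) bs∈) (weight-pair (dual σ) σ φ ψ))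

-- The atoms met so far are collected in as, at the end of the list, so that the
-- formula to be decomposed is always principal.
decide : ∀ as ss → Acc _<_ (weight ss) → Decided (ss ++ atoms as)
decide as [] _ = atoms-decided as
decide as ((σ , φ) ∷ ss) (acc rs) with atomic? φ
... | inj₁ (p , refl) =
  decided-↭ (↭-sym (shift _ ss (atoms as))) (decide ((σ , p) ∷ as) ss (rs ≤-refl))
... | inj₂ c = decided-conclusion σ φ c (ss ++ atoms as) λ {bs} bs∈ →
  decided-↭ (↭-reflexive (sym (++-assoc bs ss (atoms as))))
            (decide as (bs ++ ss) (rs (lighter bs (premises-< σ φ c bs∈))))
  where
  lighter : ∀ bs → weight bs < size φ → weight (bs ++ ss) < size φ + weight ss
  lighter bs lt = subst (_< _) (sym (weight-++ bs ss)) (+-monoˡ-< (weight ss) lt)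

decided : ∀ ss → Decided ss
decided ss = decided-↭ (↭-reflexive (sym (++-identityʳ ss))) (decide [] ss (<-wellFounded _))

mainTheorem3 : (Γ : List Formula) (φ : Formula) →
    Γ ⊨K3 φ → ⊢ (Γ ⇒ φ ∷ [] ∣ [] ⇒ [])
mainTheorem3 Γ φ Γ⊨φ with decided ((not1 , φ) ∷ map (is1 ,_) Γ)
... | inj₁ d = subst ⊢ (⟪⟫-sequent Γ φ) d
... | inj₂ (v , φ≠1 ∷ Γ=1) =
  ⊥-elim (⊩-not1 v {φ} φ≠1 (Γ⊨φ v (All.map (λ {γ} → ⊩-is1 v {γ}) (All.map⁻ Γ=1))))
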